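{- For any $k>0$ it is $g(B_k) = O(n\log\log n/\log n)$, where $B_k$ has size $n\times n$, with $n=2^k+k-1$.
   Context: For $k>0$, $D_k$ is a binary de Bruijn sequence of length $n=2^k+k-1$ containing every binary string of length $k$ exactly once. $B_k$ is the $n\times n$ matrix over the alphabet $\{\langle \texttt{0},\texttt{0}\rangle,\langle \texttt{0},\texttt{1}\rangle,\langle \texttt{1},\texttt{0}\rangle,\langle \texttt{1},\texttt{1}\rangle\}$ defined by $B_k[i][j]=\langle D_k[i],D_k[j]\rangle$. Horizontal concatenation, denoted here $A\oplus B$ (written in the paper with a rotated $\ominus$ symbol), places $B$ to the right of $A$ (equal numbers of rows); vertical concatenation $A\ominus B$ places $B$ below $A$ (equal numbers of columns). A 2D SLP is a context-free grammar uniquely generating a matrix with rules $A\to a$ (size 1), $A\to B\oplus C$, $A\to B\ominus C$ (size 2); $g(\mathcal{M})$ is the size of the smallest 2D SLP generating $\mathcal{M}$. -}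

module Defs where

open import Data.Nat using (ℕ; zero; suc; _+_; _*_; _∸_; _^_; _≤_; _<_)
open import Data.Bool using (Bool)
open import Data.Fin using (Fin; splitAt)
open import Data.Sum using (_⊎_; [_,_])
open import Data.Product using (_×_; _,_; ∃-syntax)
open import Data.List using (List; []; _∷_; length; take; drop; lookup)
open import Data.Maybe using (Maybe; just; nothing)
open import Relation.Binary.PropositionalEquality using (_≡_)

IsDeBruijn : ℕ → List Bool → Set
IsDeBruijn k D =
  (length D ≡ 2 ^ k + k ∸ 1) ×
  (∀ (w : List Bool) → length w ≡ k →
     ∃[ p ] (p < 2 ^ k × take k (drop p D) ≡ w ×
             (∀ q → q < 2 ^ k → take k (drop q D) ≡ w → q ≡ p)))

Mat : Set → ℕ → ℕ → Set
Mat A r c = Fin r → Fin c → A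

hcat : ∀ {A r c₁ c₂} → Mat A r c₁ → Mat A r c₂ → Mat A r (c₁ + c₂)
hcat {c₁ = c₁} M₁ M₂ x y = [ M₁ x , M₂ x ] (splitAt c₁ y)

vcat : ∀ {A r₁ r₂ c} → Mat A r₁ c → Mat A r₂ c → Mat A (r₁ + r₂) c
vcat {r₁ = r₁} M₁ M₂ x y = [ (λ x₁ → M₁ x₁ y) , (λ x₂ → M₂ x₂ y) ] (splitAt r₁ x)

BMat : (D : List Bool) → Mat (Bool × Bool) (length D) (length D)
BMat D i j = lookup D i , lookup D j

-- Nonterminals are numbered 0,1,2,... by their position in the rule list;
-- a concatenation rule may only refer to strictly smaller nonterminals.
data Rule (A : Set) : Set where
  term  : A → Rule A
  hrule : ℕ → ℕ → Rule A
  vrule : ℕ → ℕ → Rule A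

SLP : Set → Set
SLP A = List (Rule A)

nth : ∀ {A : Set} → List A → ℕ → Maybe A
nth []       _       = nothing
nth (x ∷ xs) zero    = just x
nth (x ∷ xs) (suc i) = nth xs i

ruleSize : ∀ {A} → Rule A → ℕ
ruleSize (term _)    = 1
ruleSize (hrule _ _) = 2
ruleSize (vrule _ _) = 2

size : ∀ {A} → SLP A → ℕ
size []       = 0
size (r ∷ rs) = ruleSize r + size rs

data Derives {A : Set} (G : SLP A) : ℕ → (r c : ℕ) → Mat A r c → Set where
  dterm : ∀ {i a} → nth G i ≡ just (term a) →
          Derives G i 1 1 (λ _ _ → a)
  dh    : ∀ {i j l r c₁ c₂ M₁ M₂} → nth G i ≡ just (hrule j l) →
          j < i → l < i →
          Derives G j r c₁ M₁ → Derives G l r c₂ M₂ →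
          Derives G i r (c₁ + c₂) (hcat M₁ M₂)
  dv    : ∀ {i j l r₁ r₂ c M₁ M₂} → nth G i ≡ just (vrule j l) →
          j < i → l < i →
          Derives G j r₁ c M₁ → Derives G l r₂ c M₂ →
          Derives G i (r₁ + r₂) c (vcat M₁ M₂)

WellFormed : ∀ {A} → SLP A → Set
WellFormed {A} G = ∀ i j l → (nth G i ≡ just (hrule j l) ⊎ nth G i ≡ just (vrule j l)) →
                   j < i × l < i

Generates : ∀ {A r c} → SLP A → Mat A r c → Set
Generates {A} {r} {c} G M =
  WellFormed G × (1 ≤ length G) ×
  ∃[ N ] (Derives G (length G ∸ 1) r c N × (∀ x y → N x y ≡ M x y))

{-# OPTIONS --safe #-}
module Submission where

-- Since B[i][j] = ⟨D[i], D[j]⟩, B has only two distinct rows,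
-- ⟨a, D[0]⟩ ... ⟨a, D[n-1]⟩ for a = 0, 1, and B is the vertical stack of these
-- two rows in the order spelled by D. So B reduces to three binary words of
-- length n over two tiles (the letters ⟨a, 0⟩, ⟨a, 1⟩ for each row, and the two
-- rows for the stack). A binary word of length n has an SLP of size
-- O(2^M + n/M): a dictionary with a nonterminal for every word of length at
-- most M, each one tile longer than an earlier one, followed by a chain of
-- n/M concatenations of dictionary entries. Taking M ≈ (log n)/2 gives
-- g(B_k) = O(n / log n), which is stronger than claimed: the factor
-- log log n ≥ 1 is simply dropped.

open import Defs
open import Data.Bool using (Bool; true; false)
open import Data.Empty using (⊥-elim)
open import Data.Fin using (Fin; toℕ; splitAt) renaming (zero to fzero; suc to fsuc)
open import Data.Fin.Properties using (toℕ-↑ˡ; toℕ-↑ʳ; splitAt⁻¹-↑ˡ; splitAt⁻¹-↑ʳ; toℕ<n)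
open import Data.List using (List; []; _∷_; length; _++_; lookup)
open import Data.List.Properties using (length-++; ++-assoc; ++-identityʳ)
open import Data.List.Relation.Unary.All using (All; []; _∷_)
open import Data.List.Relation.Unary.All.Properties using (++⁺)
open import Data.Maybe using (just)
open import Data.Nat using (ℕ; zero; suc; _+_; _*_; _∸_; _^_; _≤_; _<_; _≤′_; ≤′-refl; ≤′-step; z≤n; s≤s; s≤s⁻¹; ⌊_/2⌋; _<?_)
open import Data.Nat.DivMod using (_/_; _%_; m≡m%n+[m/n]*n; m%n<n; m/n*n≤m; /-monoˡ-≤)
open import Data.Nat.Logarithm using (⌊log₂_⌋; ⌊log₂⌋-mono-≤; ⌊log₂[2^n]⌋≡n)
open import Data.Nat.Properties
open import Data.Nat.Tactic.RingSolver using (solve-∀)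
open import Data.Product using (_×_; _,_; ∃-syntax)
open import Data.Sum using (inj₁; inj₂; [_,_])
open import Data.Unit using (⊤; tt)
open import Data.Vec using (Vec; []; _∷_)
open import Relation.Binary.PropositionalEquality hiding ([_])
open import Relation.Nullary using (yes; no)

module _ {X : Set} where

  nth-< : ∀ (xs : List X) i {x} → nth xs i ≡ just x → i < length xs
  nth-< (_ ∷ _)  zero    _ = s≤s z≤n
  nth-< (_ ∷ xs) (suc i) e = s≤s (nth-< xs i e)

  nth-++ˡ : ∀ (xs ys : List X) {i} → i < length xs → nth (xs ++ ys) i ≡ nth xs i
  nth-++ˡ (_ ∷ _)  ys {zero}  _         = refl
  nth-++ˡ (_ ∷ xs) ys {suc i} (s≤s i<n) = nth-++ˡ xs ys i<n

  nth-++ʳ : ∀ (xs ys : List X) i → nth (xs ++ ys) (length xs + i) ≡ nth ys i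
  nth-++ʳ []       ys i = refl
  nth-++ʳ (_ ∷ xs) ys i = nth-++ʳ xs ys i

  nth-++-≥ : ∀ (xs ys : List X) {i} → length xs ≤ i → nth (xs ++ ys) i ≡ nth ys (i ∸ length xs)
  nth-++-≥ []       ys _                 = refl
  nth-++-≥ (_ ∷ xs) ys {suc i} (s≤s n≤i) = nth-++-≥ xs ys n≤i

  nth-∷ʳ : ∀ (xs : List X) x → nth (xs ++ x ∷ []) (length xs) ≡ just x
  nth-∷ʳ []       x = refl
  nth-∷ʳ (_ ∷ xs) x = nth-∷ʳ xs x

  length-∷ʳ∸1 : ∀ (xs : List X) x → length (xs ++ x ∷ []) ∸ 1 ≡ length xs
  length-∷ʳ∸1 xs x = trans (cong (_∸ 1) (length-++ xs)) (m+n∸n≡m (length xs) 1)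

  All-nth : ∀ {P : X → Set} {xs i x} → All P xs → nth xs i ≡ just x → P x
  All-nth {i = zero}  (px ∷ _)  refl = px
  All-nth {i = suc i} (_ ∷ pxs) e    = All-nth pxs e

  infix 4 _≼_

  _≼_ : List X → List X → Set
  xs ≼ ys = ∃[ zs ] (ys ≡ xs ++ zs)

  ≼-refl : ∀ {xs} → xs ≼ xs
  ≼-refl {xs} = [] , sym (++-identityʳ xs)

  ≼-trans : ∀ {xs ys zs} → xs ≼ ys → ys ≼ zs → xs ≼ zs
  ≼-trans {xs} (us , refl) (vs , refl) = us ++ vs , ++-assoc xs us vs

  xs≼xs++ys : ∀ xs ys → xs ≼ xs ++ ys
  xs≼xs++ys xs ys = ys , refl

  nth-≼ : ∀ {xs ys i x} → xs ≼ ys → nth xs i ≡ just x → nth ys i ≡ just x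
  nth-≼ {xs} {i = i} (zs , refl) e = trans (nth-++ˡ xs zs (nth-< xs i e)) e

[,]-splitAt : ∀ {B : Set} c₁ {c₂} (F : ℕ → B) {f : Fin c₁ → B} {g : Fin c₂ → B} →
              (∀ a → f a ≡ F (toℕ a)) → (∀ b → g b ≡ F (c₁ + toℕ b)) →
              ∀ y → [ f , g ] (splitAt c₁ y) ≡ F (toℕ y)
[,]-splitAt c₁ {c₂} F hf hg y with splitAt c₁ y in eq
... | inj₁ a = trans (hf a) (cong F (trans (sym (toℕ-↑ˡ a c₂)) (cong toℕ (splitAt⁻¹-↑ˡ eq))))
... | inj₂ b = trans (hg b) (cong F (trans (sym (toℕ-↑ʳ c₁ b)) (cong toℕ (splitAt⁻¹-↑ʳ eq))))

module _ {A : Set} where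

  Derives-< : ∀ {G : SLP A} {i r c N} → Derives G i r c N → i < length G
  Derives-< {G} (dterm e)        = nth-< G _ e
  Derives-< {G} (dh e _ _ _ _)   = nth-< G _ e
  Derives-< {G} (dv e _ _ _ _)   = nth-< G _ e

  Derives-≼ : ∀ {G G' : SLP A} {i r c N} → G ≼ G' → Derives G i r c N → Derives G' i r c N
  Derives-≼ p (dterm e)             = dterm (nth-≼ p e)
  Derives-≼ p (dh e j<i l<i d₁ d₂) = dh (nth-≼ p e) j<i l<i (Derives-≼ p d₁) (Derives-≼ p d₂)
  Derives-≼ p (dv e j<i l<i d₁ d₂) = dv (nth-≼ p e) j<i l<i (Derives-≼ p d₁) (Derives-≼ p d₂)

  record Yields (G : SLP A) (i r c : ℕ) (S : ℕ → ℕ → A) : Set where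
    constructor yields
    field
      matrix     : Mat A r c
      derivation : Derives G i r c matrix
      agrees     : ∀ x y → matrix x y ≡ S (toℕ x) (toℕ y)

  Yields-< : ∀ {G i r c S} → Yields G i r c S → i < length G
  Yields-< (yields _ d _) = Derives-< d

  Yields-≼ : ∀ {G G' i r c S} → G ≼ G' → Yields G i r c S → Yields G' i r c S
  Yields-≼ p (yields N d eq) = yields N (Derives-≼ p d) eq

  Yields-ext : ∀ {G i r c S S'} → Yields G i r c S →
               (∀ x y → x < r → y < c → S x y ≡ S' x y) → Yields G i r c S'
  Yields-ext (yields N d eq) h = yields N d λ x y → trans (eq x y) (h (toℕ x) (toℕ y) (toℕ<n x) (toℕ<n y))

  Yields-hcat : ∀ {G i j l r c₁ c₂ S} → nth G i ≡ just (hrule j l) → j < i → l < i →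
                Yields G j r c₁ S → Yields G l r c₂ (λ x y → S x (c₁ + y)) → Yields G i r (c₁ + c₂) S
  Yields-hcat {c₁ = c₁} {S = S} e j<i l<i (yields N₁ d₁ eq₁) (yields N₂ d₂ eq₂) =
    yields (hcat N₁ N₂) (dh e j<i l<i d₁ d₂) λ x → [,]-splitAt c₁ (S (toℕ x)) (eq₁ x) (eq₂ x)

  Yields-vcat : ∀ {G i j l r₁ r₂ c S} → nth G i ≡ just (vrule j l) → j < i → l < i →
                Yields G j r₁ c S → Yields G l r₂ c (λ x y → S (r₁ + x) y) → Yields G i (r₁ + r₂) c S
  Yields-vcat {r₁ = r₁} {S = S} e j<i l<i (yields N₁ d₁ eq₁) (yields N₂ d₂ eq₂) =
    yields (vcat N₁ N₂) (dv e j<i l<i d₁ d₂) λ x y →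
      [,]-splitAt r₁ (λ z → S z (toℕ y)) (λ a → eq₁ a y) (λ b → eq₂ b y) x

  Yields⇒Generates : ∀ {G r c S} {M : Mat A r c} → WellFormed G →
                     Yields G (length G ∸ 1) r c S → (∀ x y → S (toℕ x) (toℕ y) ≡ M x y) → Generates G M
  Yields⇒Generates wf (yields N d eq) h =
    wf , ≤-<-trans z≤n (Derives-< d) , N , d , λ x y → trans (eq x y) (h x y)

  RefsBelow : ℕ → Rule A → Set
  RefsBelow b (term _)    = ⊤
  RefsBelow b (hrule j l) = j < b × l < b
  RefsBelow b (vrule j l) = j < b × l < b

  RefsBelow-≤ : ∀ {b b' r} → b ≤ b' → RefsBelow b r → RefsBelow b' r
  RefsBelow-≤ {r = term _}    _    _             = tt
  RefsBelow-≤ {r = hrule _ _} b≤b' (j<b , l<b) = <-≤-trans j<b b≤b' , <-≤-trans l<b b≤b'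
  RefsBelow-≤ {r = vrule _ _} b≤b' (j<b , l<b) = <-≤-trans j<b b≤b' , <-≤-trans l<b b≤b'

  WellFormed⇐ : ∀ {G} → (∀ i {r} → nth G i ≡ just r → RefsBelow i r) → WellFormed G
  WellFormed⇐ h i j l (inj₁ e) = h i e
  WellFormed⇐ h i j l (inj₂ e) = h i e

  WellFormed⇒ : ∀ {G} → WellFormed G → ∀ i {r} → nth G i ≡ just r → RefsBelow i r
  WellFormed⇒ wf i {term _}    _ = tt
  WellFormed⇒ wf i {hrule j l} e = wf i j l (inj₁ e)
  WellFormed⇒ wf i {vrule j l} e = wf i j l (inj₂ e)

  WellFormed-++ : ∀ (G : SLP A) {H} → WellFormed G → All (RefsBelow (length G)) H → WellFormed (G ++ H)
  WellFormed-++ G {H} wf refs = WellFormed⇐ {G ++ H} refsBelow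
    where
    refsBelow : ∀ i {r} → nth (G ++ H) i ≡ just r → RefsBelow i r
    refsBelow i e with i <? length G
    ... | yes i<G = WellFormed⇒ {G} wf i (trans (sym (nth-++ˡ G H i<G)) e)
    ... | no  i≮G = RefsBelow-≤ (≮⇒≥ i≮G) (All-nth refs (trans (sym (nth-++-≥ G H (≮⇒≥ i≮G))) e))

  size-++ : ∀ (G H : SLP A) → size (G ++ H) ≡ size G + size H
  size-++ []      H = refl
  size-++ (r ∷ G) H = trans (cong (ruleSize r +_) (size-++ G H)) (sym (+-assoc (ruleSize r) (size G) (size H)))

data Axis : Set where
  horizontal vertical : Axis

module _ {A : Set} where

  rule : Axis → ℕ → ℕ → Rule A
  rule horizontal = hrule
  rule vertical   = vrule

  ruleSize-rule : ∀ d {j l} → ruleSize (rule d j l) ≡ 2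
  ruleSize-rule horizontal = refl
  ruleSize-rule vertical   = refl

  rule-refsBelow : ∀ d {b j l} → j < b → l < b → RefsBelow b (rule d j l)
  rule-refsBelow horizontal j<b l<b = j<b , l<b
  rule-refsBelow vertical   j<b l<b = j<b , l<b

  -- A strip of length len along axis d and thickness t across it;
  -- S p q is its entry at position p along d and q across.
  data Strip : Axis → ℕ → SLP A → ℕ → ℕ → (ℕ → ℕ → A) → Set where
    hstrip : ∀ {t G i len S} → Yields G i t len (λ x y → S y x) → Strip horizontal t G i len S
    vstrip : ∀ {t G i len S} → Yields G i len t S → Strip vertical t G i len S

  Strip-< : ∀ {d t G i len S} → Strip d t G i len S → i < length G
  Strip-< (hstrip y) = Yields-< y
  Strip-< (vstrip y) = Yields-< y

  Strip-≼ : ∀ {d t G G' i len S} → G ≼ G' → Strip d t G i len S → Strip d t G' i len S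
  Strip-≼ p (hstrip y) = hstrip (Yields-≼ p y)
  Strip-≼ p (vstrip y) = vstrip (Yields-≼ p y)

  Strip-ext : ∀ {d t G i len S S'} → Strip d t G i len S →
              (∀ p q → p < len → S p q ≡ S' p q) → Strip d t G i len S'
  Strip-ext (hstrip y) h = hstrip (Yields-ext y λ x y _ y<len → h y x y<len)
  Strip-ext (vstrip y) h = vstrip (Yields-ext y λ x y x<len _ → h x y x<len)

  Strip-cat : ∀ {d t G i j l l₁ l₂ S} → nth G i ≡ just (rule d j l) → j < i → l < i →
              Strip d t G j l₁ S → Strip d t G l l₂ (λ p → S (l₁ + p)) → Strip d t G i (l₁ + l₂) S
  Strip-cat {S = S} e j<i l<i (hstrip y₁) (hstrip y₂) = hstrip (Yields-hcat {S = λ x y → S y x} e j<i l<i y₁ y₂)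
  Strip-cat {S = S} e j<i l<i (vstrip y₁) (vstrip y₂) = vstrip (Yields-vcat {S = S} e j<i l<i y₁ y₂)

-- vecAt and listAt return the junk value false past the end.
vecAt : ∀ {m} → Vec Bool m → ℕ → Bool
vecAt []      _       = false
vecAt (b ∷ _) zero    = b
vecAt (_ ∷ v) (suc p) = vecAt v p

listAt : List Bool → ℕ → Bool
listAt []       _       = false
listAt (b ∷ _)  zero    = b
listAt (_ ∷ bs) (suc p) = listAt bs p

lookup≡listAt : ∀ bs (i : Fin (length bs)) → lookup bs i ≡ listAt bs (toℕ i)
lookup≡listAt (_ ∷ _)  fzero    = refl
lookup≡listAt (_ ∷ bs) (fsuc i) = lookup≡listAt bs i

chunk : (ℕ → Bool) → (m : ℕ) → Vec Bool m
chunk w zero    = []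
chunk w (suc m) = w 0 ∷ chunk (λ p → w (suc p)) m

vecAt-chunk : ∀ w {m p} → p < m → vecAt (chunk w m) p ≡ w p
vecAt-chunk w {suc m} {zero}  _         = refl
vecAt-chunk w {suc m} {suc p} (s≤s p<m) = vecAt-chunk (λ p → w (suc p)) p<m

rank : ∀ {m} → Vec Bool m → ℕ
rank []                = 0
rank (false ∷ v)       = rank v
rank {suc m} (true ∷ v) = 2 ^ m + rank v

module _ {X : Set} where

  tabulateWords : (m : ℕ) → (Vec Bool m → X) → List X
  tabulateWords zero    R = R [] ∷ []
  tabulateWords (suc m) R = tabulateWords m (λ v → R (false ∷ v)) ++ tabulateWords m (λ v → R (true ∷ v))

  length-tabulateWords : ∀ m R → length (tabulateWords m R) ≡ 2 ^ m
  length-tabulateWords zero    R = refl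
  length-tabulateWords (suc m) R = begin
    length (tabulateWords m _ ++ tabulateWords m _)
      ≡⟨ length-++ (tabulateWords m _) ⟩
    length (tabulateWords m _) + length (tabulateWords m _)
      ≡⟨ cong₂ _+_ (length-tabulateWords m _) (length-tabulateWords m _) ⟩
    2 ^ m + 2 ^ m
      ≡⟨ cong (2 ^ m +_) (sym (+-identityʳ (2 ^ m))) ⟩
    2 ^ suc m ∎
    where open ≡-Reasoning

  nth-tabulateWords : ∀ m R v → nth (tabulateWords m R) (rank v) ≡ just (R v)
  nth-tabulateWords zero    R []          = refl
  nth-tabulateWords (suc m) R (false ∷ v) =
    nth-≼ (xs≼xs++ys (tabulateWords m (λ v → R (false ∷ v))) (tabulateWords m (λ v → R (true ∷ v))))
          (nth-tabulateWords m _ v)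
  nth-tabulateWords (suc m) R (true ∷ v)  = begin
    nth (F ++ T) (2 ^ m + rank v)       ≡⟨ cong (λ o → nth (F ++ T) (o + rank v)) (sym (length-tabulateWords m _)) ⟩
    nth (F ++ T) (length F + rank v)    ≡⟨ nth-++ʳ F T (rank v) ⟩
    nth T (rank v)                      ≡⟨ nth-tabulateWords m _ v ⟩
    just (R (true ∷ v))                 ∎
    where
    open ≡-Reasoning
    F = tabulateWords m (λ v → R (false ∷ v))
    T = tabulateWords m (λ v → R (true ∷ v))

  All-tabulateWords : ∀ {P : X → Set} m R → (∀ v → P (R v)) → All P (tabulateWords m R)
  All-tabulateWords zero    R h = h [] ∷ []
  All-tabulateWords (suc m) R h =
    ++⁺ (All-tabulateWords m _ λ v → h (false ∷ v)) (All-tabulateWords m _ λ v → h (true ∷ v))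

size-tabulateWords : ∀ {A} m (R : Vec Bool m → Rule A) → (∀ v → ruleSize (R v) ≡ 2) →
                     size (tabulateWords m R) ≡ 2 ^ suc m
size-tabulateWords zero    R h = cong (_+ 0) (h [])
size-tabulateWords (suc m) R h = begin
  size (tabulateWords m _ ++ tabulateWords m _)
    ≡⟨ size-++ (tabulateWords m _) _ ⟩
  size (tabulateWords m _) + size (tabulateWords m _)
    ≡⟨ cong₂ _+_ (size-tabulateWords m _ λ v → h (false ∷ v)) (size-tabulateWords m _ λ v → h (true ∷ v)) ⟩
  2 ^ suc m + 2 ^ suc m
    ≡⟨ cong (2 ^ suc m +_) (sym (+-identityʳ (2 ^ suc m))) ⟩
  2 ^ suc (suc m) ∎
  where open ≡-Reasoning

-- A dictionary of all words of length at most suc ℓ, plus one binary rule per block.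
compressionCost : ℕ → ℕ → ℕ
compressionCost ℓ n = 2 ^ (3 + ℓ) + n / suc ℓ * 2

blocks : ∀ ℓ n → suc ℓ < n → ∃[ q ] ∃[ r ] (r ≤ ℓ × n ≡ suc q * suc ℓ + suc r × suc q ≤ n / suc ℓ)
blocks ℓ (suc n) (s≤s 1+ℓ≤n) with n / suc ℓ in q≡ | m≡m%n+[m/n]*n n (suc ℓ)
... | zero  | n≡r+0 = ⊥-elim (<-irrefl n≡r (<-≤-trans (m%n<n n (suc ℓ)) 1+ℓ≤n))
  where
  n≡r : n % suc ℓ ≡ n
  n≡r = sym (trans n≡r+0 (+-identityʳ _))
... | suc q | n≡r+qM = q , n % suc ℓ , s≤s⁻¹ (m%n<n n (suc ℓ)) , n≡ , q<
  where
  n≡ : suc n ≡ suc q * suc ℓ + suc (n % suc ℓ)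
  n≡ = trans (cong suc (trans n≡r+qM (+-comm (n % suc ℓ) (suc q * suc ℓ))))
             (sym (+-suc (suc q * suc ℓ) (n % suc ℓ)))
  q< : suc q ≤ suc n / suc ℓ
  q< = subst (_≤ suc n / suc ℓ) q≡ (/-monoˡ-≤ (suc ℓ) (n≤1+n n))

module Compress {A : Set} (d : Axis) (t : ℕ) (G₀ : SLP A) (wf₀ : WellFormed G₀)
  (σ : Bool → ℕ → A) (tile : Bool → ℕ) (tile-strip : ∀ b → Strip d t G₀ (tile b) 1 (λ _ → σ b))
  where

  mutual
    dict : ℕ → SLP A
    dict zero    = G₀
    dict (suc j) = dict j ++ tabulateWords (2 + j) (consRule j)

    consRule : (j : ℕ) → Vec Bool (2 + j) → Rule A
    consRule j (b ∷ v) = rule d (tile b) (entry j v)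

    entry : (j : ℕ) → Vec Bool (suc j) → ℕ
    entry zero    (b ∷ []) = tile b
    entry (suc j) v        = length (dict j) + rank v

  dict-≼ : ∀ {j j'} → j ≤′ j' → dict j ≼ dict j'
  dict-≼ ≤′-refl      = ≼-refl
  dict-≼ (≤′-step j≤j') = ≼-trans (dict-≼ j≤j') (xs≼xs++ys _ _)

  tile-strip-dict : ∀ j b → Strip d t (dict j) (tile b) 1 (λ _ → σ b)
  tile-strip-dict j b = Strip-≼ (dict-≼ {j' = j} (≤⇒≤′ z≤n)) (tile-strip b)

  entry-strip : ∀ j v → Strip d t (dict j) (entry j v) (suc j) (λ p → σ (vecAt v p))
  entry-strip zero    (b ∷ []) = Strip-ext (tile-strip b) λ { zero _ _ → refl ; (suc _) _ (s≤s ()) }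
  entry-strip (suc j) (b ∷ v)  =
    Strip-cat (trans (nth-++ʳ (dict j) _ (rank (b ∷ v))) (nth-tabulateWords (2 + j) (consRule j) (b ∷ v)))
      (<-≤-trans (Strip-< head) (m≤m+n _ _)) (<-≤-trans (Strip-< tail) (m≤m+n _ _))
      (Strip-≼ (xs≼xs++ys _ _) (Strip-ext head λ { zero _ _ → refl ; (suc _) _ (s≤s ()) }))
      (Strip-≼ (xs≼xs++ys _ _) tail)
    where
    head = tile-strip-dict j b
    tail = entry-strip j v

  dict-wf : ∀ j → WellFormed (dict j)
  dict-wf zero    = wf₀
  dict-wf (suc j) = WellFormed-++ (dict j) (dict-wf j) (All-tabulateWords (2 + j) (consRule j) λ
    { (b ∷ v) → rule-refsBelow d (Strip-< (tile-strip-dict j b)) (Strip-< (entry-strip j v)) })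

  size-dict : ∀ j → size (dict j) ≤ size G₀ + 2 ^ (3 + j)
  size-dict zero    = m≤m+n _ _
  size-dict (suc j) = begin
    size (dict j ++ tabulateWords (2 + j) (consRule j))
      ≡⟨ size-++ (dict j) _ ⟩
    size (dict j) + size (tabulateWords (2 + j) (consRule j))
      ≡⟨ cong (size (dict j) +_) (size-tabulateWords (2 + j) (consRule j) λ { (_ ∷ _) → ruleSize-rule d }) ⟩
    size (dict j) + 2 ^ (3 + j)
      ≤⟨ +-monoˡ-≤ _ (size-dict j) ⟩
    size G₀ + 2 ^ (3 + j) + 2 ^ (3 + j)
      ≡⟨ +-assoc (size G₀) _ _ ⟩
    size G₀ + (2 ^ (3 + j) + 2 ^ (3 + j))
      ≡⟨ cong (λ x → size G₀ + (2 ^ (3 + j) + x)) (sym (+-identityʳ _)) ⟩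
    size G₀ + 2 ^ (3 + suc j) ∎
    where open ≤-Reasoning

  module Chain (ℓ r : ℕ) (r≤ℓ : r ≤ ℓ) where

    skip : (ℕ → Bool) → ℕ → Bool
    skip w p = w (suc ℓ + p)

    mutual
      chain : ℕ → (ℕ → Bool) → SLP A
      chain zero    w = dict ℓ
      chain (suc q) w = chain q (skip w) ++ rule d (entry ℓ (chunk w (suc ℓ))) (chainTop q (skip w)) ∷ []

      chainTop : ℕ → (ℕ → Bool) → ℕ
      chainTop zero    w = entry r (chunk w (suc r))
      chainTop (suc q) w = length (chain q (skip w))

    dict≼chain : ∀ q w → dict ℓ ≼ chain q w
    dict≼chain zero    w = ≼-refl
    dict≼chain (suc q) w = ≼-trans (dict≼chain q (skip w)) (xs≼xs++ys _ _)

    block-strip : ∀ q w → Strip d t (chain q (skip w)) (entry ℓ (chunk w (suc ℓ))) (suc ℓ) (λ p → σ (w p))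
    block-strip q w =
      Strip-ext (Strip-≼ (dict≼chain q (skip w)) (entry-strip ℓ (chunk w (suc ℓ))))
        λ p q p<ℓ → cong (λ b → σ b q) (vecAt-chunk w p<ℓ)

    chain-strip : ∀ q w → Strip d t (chain q w) (chainTop q w) (q * suc ℓ + suc r) (λ p → σ (w p))
    chain-strip zero    w =
      Strip-ext (Strip-≼ (dict-≼ (≤⇒≤′ r≤ℓ)) (entry-strip r (chunk w (suc r))))
        λ p q p<r → cong (λ b → σ b q) (vecAt-chunk w p<r)
    chain-strip (suc q) w =
      subst (λ len → Strip d t (chain (suc q) w) (chainTop (suc q) w) len (λ p → σ (w p)))
        (sym (+-assoc (suc ℓ) (q * suc ℓ) (suc r)))
        (Strip-cat (nth-∷ʳ (chain q (skip w)) _) (Strip-< block) (Strip-< rest)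
          (Strip-≼ (xs≼xs++ys _ _) block) (Strip-≼ (xs≼xs++ys _ _) rest))
      where
      block = block-strip q w
      rest  = chain-strip q (skip w)

    chain-wf : ∀ q w → WellFormed (chain q w)
    chain-wf zero    w = dict-wf ℓ
    chain-wf (suc q) w = WellFormed-++ (chain q (skip w)) (chain-wf q (skip w))
      (rule-refsBelow d (Strip-< (block-strip q w)) (Strip-< (chain-strip q (skip w))) ∷ [])

    size-chain : ∀ q w → size (chain q w) ≡ size (dict ℓ) + q * 2
    size-chain zero    w = sym (+-identityʳ _)
    size-chain (suc q) w = begin
      size (chain q (skip w) ++ rule d _ _ ∷ [])
        ≡⟨ size-++ (chain q (skip w)) _ ⟩
      size (chain q (skip w)) + (ruleSize (rule d _ _) + 0)
        ≡⟨ cong₂ (λ x y → x + (y + 0)) (size-chain q (skip w)) (ruleSize-rule d) ⟩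
      size (dict ℓ) + q * 2 + 2
        ≡⟨ +-assoc (size (dict ℓ)) (q * 2) 2 ⟩
      size (dict ℓ) + (q * 2 + 2)
        ≡⟨ cong (size (dict ℓ) +_) (+-comm (q * 2) 2) ⟩
      size (dict ℓ) + suc q * 2 ∎
      where open ≡-Reasoning

  compress : ∀ ℓ n (w : ℕ → Bool) → suc ℓ < n →
             ∃[ G ] (WellFormed G × G₀ ≼ G × Strip d t G (length G ∸ 1) n (λ p → σ (w p)) ×
                     size G ≤ size G₀ + compressionCost ℓ n)
  compress ℓ n w 1+ℓ<n with blocks ℓ n 1+ℓ<n
  ... | q , r , r≤ℓ , refl , q≤ =
    chain (suc q) w , chain-wf (suc q) w , ≼-trans (dict-≼ {j' = ℓ} (≤⇒≤′ z≤n)) (dict≼chain (suc q) w) ,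
    subst (λ i → Strip d t (chain (suc q) w) i len (λ p → σ (w p)))
          (sym (length-∷ʳ∸1 (chain q (skip w)) _)) (chain-strip (suc q) w) ,
    size≤
    where
    open Chain ℓ r r≤ℓ
    len = suc q * suc ℓ + suc r
    size≤ : size (chain (suc q) w) ≤ size G₀ + compressionCost ℓ len
    size≤ = begin
      size (chain (suc q) w)                   ≡⟨ size-chain (suc q) w ⟩
      size (dict ℓ) + suc q * 2                ≤⟨ +-mono-≤ (size-dict ℓ) (*-monoˡ-≤ 2 q≤) ⟩
      size G₀ + 2 ^ (3 + ℓ) + len / suc ℓ * 2  ≡⟨ +-assoc (size G₀) (2 ^ (3 + ℓ)) _ ⟩
      size G₀ + compressionCost ℓ len          ∎
      where open ≤-Reasoning

Cell : Set
Cell = Bool × Bool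

letterRule : Vec Bool 2 → Rule Cell
letterRule (a ∷ b ∷ []) = term (a , b)

letters : SLP Cell
letters = tabulateWords 2 letterRule

letters-wf : WellFormed letters
letters-wf = WellFormed-++ [] (λ { _ _ _ (inj₁ ()) ; _ _ _ (inj₂ ()) })
                             (All-tabulateWords 2 letterRule λ { (_ ∷ _ ∷ []) → tt })

letter : Bool → Bool → ℕ
letter a b = rank (a ∷ b ∷ [])

letter-strip : ∀ {G} → letters ≼ G → ∀ a b → Strip horizontal 1 G (letter a b) 1 (λ _ _ → a , b)
letter-strip p a b =
  hstrip (Yields-≼ p (yields _ (dterm (nth-tabulateWords 2 letterRule (a ∷ b ∷ []))) λ _ _ → refl))

pairMatrix-grammar : ∀ n (w : ℕ → Bool) h → suc h < n →
  ∃[ G ] (WellFormed G × Yields G (length G ∸ 1) n n (λ x y → w x , w y) ×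
          size G ≤ 4 + compressionCost h n + compressionCost h n + compressionCost h n)
pairMatrix-grammar n w h 1+h<n
  with Compress.compress horizontal 1 letters letters-wf (λ b _ → false , b) (letter false)
         (letter-strip ≼-refl false) h n w 1+h<n
... | G₁ , wf₁ , letters≼G₁ , hstrip row₁ , size₁
  with Compress.compress horizontal 1 G₁ wf₁ (λ b _ → true , b) (letter true)
         (letter-strip letters≼G₁ true) h n w 1+h<n
... | G₂ , wf₂ , G₁≼G₂ , hstrip row₂ , size₂
  with Compress.compress vertical n G₂ wf₂ (λ a y → a , w y)
         (λ { false → length G₁ ∸ 1 ; true → length G₂ ∸ 1 })
         (λ { false → vstrip (Yields-≼ G₁≼G₂ row₁) ; true → vstrip row₂ }) h n w 1+h<n
... | G₃ , wf₃ , _ , vstrip matrix , size₃ =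
  G₃ , wf₃ , matrix , ≤-trans size₃ (+-monoˡ-≤ _ (≤-trans size₂ (+-monoˡ-≤ _ size₁)))

n<2^n : ∀ n → n < 2 ^ n
n<2^n zero    = s≤s z≤n
n<2^n (suc n) = ≤-trans (+-mono-≤ (m^n>0 2 n) (n<2^n n))
                        (≤-reflexive (cong (2 ^ n +_) (sym (+-identityʳ (2 ^ n)))))

⌊n/2⌋+⌊n/2⌋≤n : ∀ n → ⌊ n /2⌋ + ⌊ n /2⌋ ≤ n
⌊n/2⌋+⌊n/2⌋≤n n = ≤-trans (+-monoʳ-≤ ⌊ n /2⌋ (⌊n/2⌋≤⌈n/2⌉ n)) (≤-reflexive (⌊n/2⌋+⌈n/2⌉≡n n))

1+n≤[1+⌊n/2⌋]+[1+⌊n/2⌋] : ∀ n → suc n ≤ suc ⌊ n /2⌋ + suc ⌊ n /2⌋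
1+n≤[1+⌊n/2⌋]+[1+⌊n/2⌋] n =
  s≤s (≤-trans (≤-reflexive (sym (⌊n/2⌋+⌈n/2⌉≡n n))) (+-monoʳ-≤ ⌊ n /2⌋ (⌊n/2⌋-mono (n≤1+n (suc n)))))

1+⌊n/2⌋<2^n : ∀ {n} → 1 ≤ n → suc ⌊ n /2⌋ < 2 ^ n
1+⌊n/2⌋<2^n {suc n} _ = ≤-<-trans (⌊n/2⌋<n n) (n<2^n (suc n))

2^k≤2^k+k∸1 : ∀ {k} → 1 ≤ k → 2 ^ k ≤ 2 ^ k + k ∸ 1
2^k≤2^k+k∸1 {k} 1≤k = ≤-trans (m≤m+n (2 ^ k) (k ∸ 1)) (≤-reflexive (sym (+-∸-assoc (2 ^ k) 1≤k)))

2^k+k∸1≤2^[1+k] : ∀ k → 2 ^ k + k ∸ 1 ≤ 2 ^ suc k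
2^k+k∸1≤2^[1+k] k = begin
  2 ^ k + k ∸ 1      ≤⟨ m∸n≤m (2 ^ k + k) 1 ⟩
  2 ^ k + k          ≤⟨ +-monoʳ-≤ (2 ^ k) (<⇒≤ (n<2^n k)) ⟩
  2 ^ k + 2 ^ k      ≡⟨ cong (2 ^ k +_) (sym (+-identityʳ (2 ^ k))) ⟩
  2 ^ suc k          ∎
  where open ≤-Reasoning

size-log-bound : ∀ {s L} n h → s ≤ 4 + compressionCost h n + compressionCost h n + compressionCost h n →
                 L ≤ suc h + suc h → 2 ^ h * 2 ^ h ≤ n → s * L ≤ 68 * n
size-log-bound {s} {L} n h s≤ L≤ square≤ = begin
  s * L                                        ≤⟨ *-mono-≤ s≤ L≤ ⟩
  (4 + c + c + c) * (M + M)                    ≡⟨ cong (λ x → (4 + x + x + x) * (M + M)) c≡ ⟩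
  (4 + c′ + c′ + c′) * (M + M)                 ≡⟨ expand M Y Q ⟩
  8 * M + 48 * (Y * M) + 12 * (Q * M)          ≤⟨ +-mono-≤ (+-mono-≤ (*-monoʳ-≤ 8 M≤n) (*-monoʳ-≤ 48 YM≤n))
                                                           (*-monoʳ-≤ 12 (m/n*n≤m n M)) ⟩
  8 * n + 48 * n + 12 * n                      ≡⟨ collect n ⟩
  68 * n                                       ∎
  where
  open ≤-Reasoning
  expand : ∀ M Y Q → (4 + (8 * Y + Q * 2) + (8 * Y + Q * 2) + (8 * Y + Q * 2)) * (M + M) ≡
                     8 * M + 48 * (Y * M) + 12 * (Q * M)
  expand = solve-∀
  collect : ∀ n → 8 * n + 48 * n + 12 * n ≡ 68 * n
  collect = solve-∀
  M = suc h
  Y = 2 ^ h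
  Q = n / M
  c = compressionCost h n
  c′ = 8 * Y + Q * 2
  c≡ : c ≡ c′
  c≡ = cong (_+ Q * 2) (^-distribˡ-+-* 2 3 h)
  YM≤n : Y * M ≤ n
  YM≤n = ≤-trans (*-monoʳ-≤ Y (n<2^n h)) square≤
  M≤n : M ≤ n
  M≤n = ≤-trans (≤-trans (≤-reflexive (sym (*-identityˡ M))) (*-monoˡ-≤ M (m^n>0 2 h))) YM≤n

pairMatrix-grammar-log : ∀ k n (w : ℕ → Bool) → 1 ≤ k → 2 ^ k ≤ n → n ≤ 2 ^ suc k →
  ∃[ G ] (WellFormed G × Yields G (length G ∸ 1) n n (λ x y → w x , w y) × size G * ⌊log₂ n ⌋ ≤ 68 * n)
pairMatrix-grammar-log k n w 1≤k 2^k≤n n≤2^[1+k]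
  with pairMatrix-grammar n w ⌊ k /2⌋ (<-≤-trans (1+⌊n/2⌋<2^n 1≤k) 2^k≤n)
... | G , wf , matrix , size≤ = G , wf , matrix , size-log-bound n ⌊ k /2⌋ size≤ log≤ square≤
  where
  open ≤-Reasoning
  log≤ : ⌊log₂ n ⌋ ≤ suc ⌊ k /2⌋ + suc ⌊ k /2⌋
  log≤ = begin
    ⌊log₂ n ⌋              ≤⟨ ⌊log₂⌋-mono-≤ n≤2^[1+k] ⟩
    ⌊log₂ (2 ^ suc k) ⌋    ≡⟨ ⌊log₂[2^n]⌋≡n (suc k) ⟩
    suc k                   ≤⟨ 1+n≤[1+⌊n/2⌋]+[1+⌊n/2⌋] k ⟩
    suc ⌊ k /2⌋ + suc ⌊ k /2⌋ ∎
  square≤ : 2 ^ ⌊ k /2⌋ * 2 ^ ⌊ k /2⌋ ≤ n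
  square≤ = begin
    2 ^ ⌊ k /2⌋ * 2 ^ ⌊ k /2⌋  ≡⟨ ^-distribˡ-+-* 2 ⌊ k /2⌋ ⌊ k /2⌋ ⟨
    2 ^ (⌊ k /2⌋ + ⌊ k /2⌋)    ≤⟨ ^-monoʳ-≤ 2 (⌊n/2⌋+⌊n/2⌋≤n k) ⟩
    2 ^ k                       ≤⟨ 2^k≤n ⟩
    n                           ∎

lemma6 : ∃[ C ] ∃[ K ] (∀ (k : ℕ) → 0 < k → K ≤ k → ∀ (D : List Bool) → IsDeBruijn k D →
           ∃[ G ] (Generates G (BMat D) ×
             size G * ⌊log₂ (length D) ⌋ ≤ C * length D * ⌊log₂ ⌊log₂ (length D) ⌋ ⌋))
lemma6 = 68 , 2 , BMat-bound
  where
  BMat-bound : ∀ k → 0 < k → 2 ≤ k → ∀ D → IsDeBruijn k D →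
               ∃[ G ] (Generates G (BMat D) ×
                 size G * ⌊log₂ (length D) ⌋ ≤ 68 * length D * ⌊log₂ ⌊log₂ (length D) ⌋ ⌋)
  BMat-bound k 0<k 2≤k D (length≡ , _) = conclude (pairMatrix-grammar-log k n (listAt D) 0<k 2^k≤n n≤2^[1+k])
    where
    n = length D
    2^k≤n : 2 ^ k ≤ n
    2^k≤n = subst (2 ^ k ≤_) (sym length≡) (2^k≤2^k+k∸1 0<k)
    n≤2^[1+k] : n ≤ 2 ^ suc k
    n≤2^[1+k] = subst (_≤ 2 ^ suc k) (sym length≡) (2^k+k∸1≤2^[1+k] k)
    1≤loglog : 1 ≤ ⌊log₂ ⌊log₂ n ⌋ ⌋
    1≤loglog = ⌊log₂⌋-mono-≤ {2} (⌊log₂⌋-mono-≤ {4} (≤-trans (^-monoʳ-≤ 2 2≤k) 2^k≤n))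
    conclude : ∃[ G ] (WellFormed G × Yields G (length G ∸ 1) n n (λ x y → listAt D x , listAt D y) ×
                       size G * ⌊log₂ n ⌋ ≤ 68 * n) →
               ∃[ G ] (Generates G (BMat D) × size G * ⌊log₂ n ⌋ ≤ 68 * n * ⌊log₂ ⌊log₂ n ⌋ ⌋)
    conclude (G , wf , matrix , size≤) =
      G , Yields⇒Generates wf matrix (λ x y → sym (cong₂ _,_ (lookup≡listAt D x) (lookup≡listAt D y))) ,
      ≤-trans size≤ (≤-trans (≤-reflexive (sym (*-identityʳ (68 * n)))) (*-monoʳ-≤ (68 * n) 1≤loglog))
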